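{- Let $(R_n)_{n\ge1}$ be an ambient chain as described in the context, and let $(\mathrm{cl}_n)_{n\ge1}$ be closure operations on the $R_n$ compatible with $\mathrm{Inc}$. Let $\mathcal A=(A_n)_{n\ge1}$ be an $\mathrm{Inc}$-invariant, $(\mathrm{cl}_n)$-closed chain. Then for $r\in\mathbb N$ the following are equivalent: (i) $\mathcal A$ stabilizes and its stability index is at most $r$, i.e. $(\mathrm{Inc}_{m,n}(A_m))^{\mathrm{cl}_n}=A_n$ for all $n\ge m\ge r$; (ii) $(\mathrm{Inc}_{n,n+1}(A_n))^{\mathrm{cl}_{n+1}}=A_{n+1}$ for all $n\ge r$; (iii) $(\mathrm{Inc}_{r,n}(A_r))^{\mathrm{cl}_n}=A_n$ for all $n\ge r$.
   Context: The ambient chain is one of two types. Type 1: $K$ a field, $c\ge1$, $R_n=K[x_{i,j}:i\in[c],j\in[n]]$, $R_n\subseteq R_{n+1}$. Type 2: $R_n\subseteq\mathbb R^n$, with $\mathbb R^m\subseteq\mathbb R^n$ via $v\mapsto(v,0,\dots,0)$, $R_m\subseteq R_n$ for $m\le n$, and $\pi(R_m)\subseteq R_n$ for every injective $\pi:[m]\to[n]$. An injective $\pi:[m]\to[n]$ acts $R_m\to R_n$ by $\pi(\sum_kv_k\epsilon_k)=\sum_kv_k\epsilon_{\pi(k)}$ (type 2) or as the $K$-algebra homomorphism $x_{i,j}\mapsto x_{i,\pi(j)}$ (type 1). $\mathrm{Inc}$ is the monoid of strictly increasing maps $\mathbb N\to\mathbb N$, $\mathrm{Inc}_{m,n}=\{\pi\in\mathrm{Inc}:\pi(m)\le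 n\}$, and $\pi\in\mathrm{Inc}_{m,n}$ acts $R_m\to R_n$ via its restriction to $[m]$. A closure operation on $X$: $A\mapsto A^{\mathrm{cl}}$ on subsets with $A\subseteq A^{\mathrm{cl}}$, $(A^{\mathrm{cl}})^{\mathrm{cl}}=A^{\mathrm{cl}}$, monotone. Compatible with $\mathrm{Inc}$: $\mathrm{Inc}_{m,n}(A^{\mathrm{cl}_m})\subseteq(\mathrm{Inc}_{m,n}(A))^{\mathrm{cl}_n}$ for all $n\ge m$, $A\subseteq R_m$. A chain has $A_n\subseteq R_n$, $A_n\subseteq A_{n+1}$; $(\mathrm{cl}_n)$-closed if each $A_n$ is $\mathrm{cl}_n$-closed; $\mathrm{Inc}$-invariant if $(\mathrm{Inc}_{m,n}(A_m))^{\mathrm{cl}_n}\subseteq A_n$ for all $n\ge m$. -}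

module Defs where

open import Level using (0ℓ)
open import Data.Nat using (ℕ; zero; suc; _≤_; _<_; _∸_; s≤s; z≤n)
open import Data.Nat.Properties using (≤-trans; <-trans; ≤-refl; <⇒≤; ≤-pred; <-irrefl; <-cmp)
open import Data.Fin using (Fin; toℕ; fromℕ<; inject₁)
open import Data.Fin.Properties using (toℕ<n; toℕ-fromℕ<; toℕ-injective; inject₁-injective)
open import Data.Product using (Σ; ∃; _×_; _,_)
open import Function using (_∘_; id)
open import Function.Definitions using (Injective)
open import Relation.Binary.PropositionalEquality using (_≡_; refl; sym; trans; cong; _≗_)
open import Relation.Unary using (Pred; _∈_; _⊆_; _≐_)
open import Relation.Binary using (Tri; tri<; tri≈; tri>)
open import Data.Empty using (⊥-elim)

-- R n is the n-th set of the chain; an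
-- injective map π : [m] → [n] (here Fin m → Fin n, 0-based) acts
-- R m → R n.
-- The chain inclusion R m ⊆ R n is the action of the standard
-- inclusion [m] ↪ [n] (this holds for both type 1 and type 2).

record AmbientChain : Set₁ where
  field
    R   : ℕ → Set
    act : ∀ {m n} (f : Fin m → Fin n) → Injective _≡_ _≡_ f → R m → R n
    act-ext : ∀ {m n} (f g : Fin m → Fin n)
              (p : Injective _≡_ _≡_ f) (q : Injective _≡_ _≡_ g) →
              f ≗ g → ∀ x → act f p x ≡ act g q x
    act-id  : ∀ {m} (p : Injective _≡_ _≡_ (id {A = Fin m})) →
              ∀ x → act id p x ≡ x
    act-∘   : ∀ {l m n} (f : Fin l → Fin m) (g : Fin m → Fin n)
              (p : Injective _≡_ _≡_ f) (q : Injective _≡_ _≡_ g)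
              (r : Injective _≡_ _≡_ (g ∘ f)) →
              ∀ x → act (g ∘ f) r x ≡ act g q (act f p x)

  incl : ∀ {n} → R n → R (suc n)
  incl = act inject₁ inject₁-injective

-- Inc: strictly increasing maps ℕ → ℕ.  We use 0-based indices: the
-- paper's map k ↦ π(k) on {1,2,…} corresponds to i ↦ f i with
-- π(i+1) = f i + 1.

record Inc : Set where
  field
    f    : ℕ → ℕ
    mono : ∀ {i j} → i < j → f i < f j
open Inc public

inc-≤ : (π : Inc) → ∀ {i j} → i ≤ j → f π i ≤ f π j
inc-≤ π {i} {j} i≤j with <-cmp i j
... | tri< i<j _ _ = <⇒≤ (mono π i<j)
... | tri≈ _ refl _ = ≤-refl
... | tri> _ _ j<i = ⊥-elim (<-irrefl refl (≤-trans (s≤s i≤j) j<i))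

inc-inj : (π : Inc) → ∀ {i j} → f π i ≡ f π j → i ≡ j
inc-inj π {i} {j} e with <-cmp i j
... | tri< i<j _ _ = ⊥-elim (<-irrefl e (mono π i<j))
... | tri≈ _ i≡j _ = i≡j
... | tri> _ _ j<i = ⊥-elim (<-irrefl (sym e) (mono π j<i))

-- π ∈ Inc_{m,n}  :⇔  π(m) ≤ n   (in 0-based form: f (m-1) + 1 ≤ n)
IncMN : ℕ → ℕ → Inc → Set
IncMN m n π = suc (f π (m ∸ 1)) ≤ n

private
  toℕ≤pred : ∀ {m} (i : Fin m) → toℕ i ≤ m ∸ 1
  toℕ≤pred {suc m} i = ≤-pred (toℕ<n i)

restrict : ∀ {m n} (π : Inc) → IncMN m n π → Fin m → Fin n
restrict {m} π p i = fromℕ< (≤-trans (s≤s (inc-≤ π (toℕ≤pred {m} i))) p)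

restrict-inj : ∀ {m n} (π : Inc) (p : IncMN m n π) →
               Injective _≡_ _≡_ (restrict {m} {n} π p)
restrict-inj {m} {n} π p {i} {j} e = toℕ-injective (inc-inj π
  (trans (sym (toℕ-fromℕ< (≤-trans (s≤s (inc-≤ π (toℕ≤pred {m} i))) p))) (trans (cong toℕ e) (toℕ-fromℕ< (≤-trans (s≤s (inc-≤ π (toℕ≤pred {m} j))) p)))))

module _ (C : AmbientChain) where
  open AmbientChain C

  actInc : ∀ {m n} (π : Inc) → IncMN m n π → R m → R n
  actInc {m} {n} π p = act (restrict {m} {n} π p) (restrict-inj {m} {n} π p)

  IncImg : (m n : ℕ) → Pred (R m) 0ℓ → Pred (R n) 0ℓ
  IncImg m n A y = Σ Inc λ π → Σ (IncMN m n π) λ p →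
                   Σ (R m) λ x → x ∈ A × y ≡ actInc {m} {n} π p x

record ClosureOp (X : Set) : Set₁ where
  field
    cl        : Pred X 0ℓ → Pred X 0ℓ
    extensive : ∀ A → A ⊆ cl A
    idempotent : ∀ A → cl (cl A) ≐ cl A
    monotone  : ∀ {A B} → A ⊆ B → cl A ⊆ cl B

module _ (C : AmbientChain) where
  open AmbientChain C

  -- A family of closure operations (cl_n) on the R n; only n ≥ 1 matter.
  ClosureFamily : Set₁
  ClosureFamily = (n : ℕ) → ClosureOp (R n)

  module _ (CL : ClosureFamily) where
    cl : (n : ℕ) → Pred (R n) 0ℓ → Pred (R n) 0ℓ
    cl n = ClosureOp.cl (CL n)

    CompatibleWithInc : Set₁
    CompatibleWithInc = ∀ m n → 1 ≤ m → m ≤ n → (A : Pred (R m) 0ℓ) →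
      IncImg C m n (cl m A) ⊆ cl n (IncImg C m n A)

    -- A chain (A_n)_{n ≥ 1}: A n ⊆ R n and A n ⊆ A (n+1)
    -- (values at index 0 are irrelevant junk)
    IsChain : ((n : ℕ) → Pred (R n) 0ℓ) → Set
    IsChain A = ∀ n → 1 ≤ n → ∀ x → x ∈ A n → incl x ∈ A (suc n)

    IsClosedChain : ((n : ℕ) → Pred (R n) 0ℓ) → Set
    IsClosedChain A = ∀ n → 1 ≤ n → cl n (A n) ⊆ A n

    IsIncInvariant : ((n : ℕ) → Pred (R n) 0ℓ) → Set
    IsIncInvariant A = ∀ m n → 1 ≤ m → m ≤ n →
      cl n (IncImg C m n (A m)) ⊆ A n

-- Inc-invariance gives one inclusion of every equality in (i)–(iii), so only
-- A_n ⊆ cl_n(Inc_{m,n}(A_m)) is at stake.  Compatibility and idempotence make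
-- "generated by" transitive, so (ii) ⇒ (i) by chaining one-step extensions.
-- For (iii) ⇒ (i), every π ∈ Inc_{r,n} factors through [m] (r ≤ m ≤ n) as
-- σ ∘ τ with τ ∈ Inc_{r,m}, σ ∈ Inc_{m,n}, and Inc_{r,m}(A_r) ⊆ A_m.
module Submission where

open import Defs
open import Level using (0ℓ)
open import Data.Nat using (ℕ; suc; _≤_; _<_; _≤′_; ≤′-refl; ≤′-step; _+_; _∸_; _⊔_; _⊓_; s≤s; s≤s⁻¹; z≤n; _≤?_)
open import Data.Nat.Properties
open import Data.Product using (Σ; _×_; _,_; proj₁; proj₂)
open import Data.Fin using (Fin; toℕ)
open import Data.Fin.Properties using (toℕ-fromℕ<; toℕ-injective)
open import Function using (_∘_; id)
open import Function.Bundles using (_⇔_; mk⇔)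
open import Relation.Unary using (Pred; _≐_; _⊆_)
open import Relation.Binary.PropositionalEquality
open import Relation.Nullary using (yes; no)

idᴵ : Inc
idᴵ = record { f = id ; mono = id }

infixr 9 _∘ᴵ_
_∘ᴵ_ : Inc → Inc → Inc
σ ∘ᴵ τ = record { f = f σ ∘ f τ ; mono = mono σ ∘ mono τ }

IncMN-id : ∀ {m} → 1 ≤ m → IncMN m m idᴵ
IncMN-id {suc m} _ = ≤-refl

IncMN-∘ : ∀ {l m n} {σ τ : Inc} → IncMN m n σ → IncMN l m τ → IncMN l n (σ ∘ᴵ τ)
IncMN-∘ {m = suc m} {σ = σ} p q = ≤-trans (s≤s (inc-≤ σ (s≤s⁻¹ q))) p

-- For π ∈ Inc_{r,m+e} this splits π as outer ∘ inner with inner ∈ Inc_{r,m}: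
-- inner lowers π by e but never below the identity, outer undoes it.
module _ (e : ℕ) (π : Inc) where

  inner : Inc
  inner = record { f = λ i → i ⊔ (f π i ∸ e) ; mono = inner-mono }
    where
    inner-mono : ∀ {i j} → i < j → i ⊔ (f π i ∸ e) < j ⊔ (f π j ∸ e)
    inner-mono {i} {j} i<j = ⊔-pres-<m (<-≤-trans i<j (m≤m⊔n j _)) shifted<
      where
      shifted< : f π i ∸ e < j ⊔ (f π j ∸ e)
      shifted< with e ≤? f π i
      ... | yes e≤πi = <-≤-trans (∸-monoˡ-< (mono π i<j) e≤πi) (m≤n⊔m j _)
      ... | no  e≰πi = subst (_< j ⊔ (f π j ∸ e)) (sym (m≤n⇒m∸n≡0 (<⇒≤ (≰⇒> e≰πi))))
                             (<-≤-trans (≤-<-trans z≤n i<j) (m≤m⊔n j _))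

  outer : Inc
  outer = record { f = λ j → f π j ⊓ (j + e)
                 ; mono = λ i<j → ⊓-mono-< (mono π i<j) (+-monoˡ-< e i<j) }

  outer∘inner : ∀ i → f outer (f inner i) ≡ f π i
  outer∘inner i with i + e ≤? f π i
  ... | yes i+e≤πi = begin
      f π (i ⊔ (f π i ∸ e)) ⊓ (i ⊔ (f π i ∸ e) + e) ≡⟨ cong (λ k → f π k ⊓ (k + e)) (m≤n⇒m⊔n≡n i≤πi∸e) ⟩
      f π (f π i ∸ e) ⊓ (f π i ∸ e + e)             ≡⟨ cong (f π (f π i ∸ e) ⊓_) (m∸n+n≡m (m+n≤o⇒n≤o i i+e≤πi)) ⟩
      f π (f π i ∸ e) ⊓ f π i                       ≡⟨ m≥n⇒m⊓n≡n (inc-≤ π i≤πi∸e) ⟩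
      f π i                                         ∎
    where
    open ≡-Reasoning
    i≤πi∸e : i ≤ f π i ∸ e
    i≤πi∸e = m+n≤o⇒m≤o∸n i i+e≤πi
  ... | no i+e≰πi = begin
      f π (i ⊔ (f π i ∸ e)) ⊓ (i ⊔ (f π i ∸ e) + e) ≡⟨ cong (λ k → f π k ⊓ (k + e)) (m≥n⇒m⊔n≡m πi∸e≤i) ⟩
      f π i ⊓ (i + e)                               ≡⟨ m≤n⇒m⊓n≡m πi≤i+e ⟩
      f π i                                         ∎
    where
    open ≡-Reasoning
    πi≤i+e : f π i ≤ i + e
    πi≤i+e = <⇒≤ (≰⇒> i+e≰πi)
    πi∸e≤i : f π i ∸ e ≤ i
    πi∸e≤i = m≤n+o⇒m∸n≤o (f π i) e (subst (f π i ≤_) (+-comm i e) πi≤i+e)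

inner-IncMN : ∀ {r m} e (π : Inc) → 1 ≤ r → r ≤ m → IncMN r (m + e) π → IncMN r m (inner e π)
inner-IncMN {suc r} {suc m} e π _ r≤m p =
  ⊔-lub r≤m (m<n+o⇒m∸n<o (f π r) e (subst (f π r <_) (+-comm (suc m) e) p))

outer-IncMN : ∀ {m} e (π : Inc) → 1 ≤ m → IncMN m (m + e) (outer e π)
outer-IncMN {suc m} e π _ = s≤s (m⊓n≤n _ _)

Inc-factor : ∀ {r m n} (π : Inc) → 1 ≤ r → r ≤ m → m ≤ n → IncMN r n π →
             Σ Inc λ τ → Σ Inc λ σ → IncMN r m τ × IncMN m n σ × (f σ ∘ f τ ≗ f π)
Inc-factor {r} {m} π 1≤r r≤m m≤n p with m≤n⇒∃[o]m+o≡n m≤n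
... | e , refl = inner e π , outer e π , inner-IncMN e π 1≤r r≤m p
               , outer-IncMN e π (≤-trans 1≤r r≤m) , outer∘inner e π

module _ (C : AmbientChain) where
  open AmbientChain C

  restrict-≗ : ∀ {m n} (π : Inc) (p : IncMN m n π) (g : Fin m → Fin n) →
               (∀ i → f π (toℕ i) ≡ toℕ (g i)) → restrict {m} {n} π p ≗ g
  restrict-≗ π p g h i = toℕ-injective (trans (toℕ-fromℕ< _) (h i))

  actInc-id : ∀ {m} (p : IncMN m m idᴵ) x → actInc C {m} {m} idᴵ p x ≡ x
  actInc-id {m} p x =
    trans (act-ext _ id (restrict-inj {m} {m} idᴵ p) id (restrict-≗ {m} idᴵ p id (λ _ → refl)) x)
          (act-id id x)

  actInc-∘ : ∀ {l m n} (τ σ π : Inc) (q : IncMN l m τ) (p : IncMN m n σ) (s : IncMN l n π) →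
             f σ ∘ f τ ≗ f π → ∀ x →
             actInc C {l} {n} π s x ≡ actInc C {m} {n} σ p (actInc C {l} {m} τ q x)
  actInc-∘ {l} {m} {n} τ σ π q p s στ≗π x =
    trans (act-ext _ (ρσ ∘ ρτ) (restrict-inj {l} {n} π s) (injτ ∘ injσ) (restrict-≗ {l} π s _ agree) x)
          (act-∘ ρτ ρσ injτ injσ (injτ ∘ injσ) x)
    where
    ρτ = restrict {l} {m} τ q
    ρσ = restrict {m} {n} σ p
    injτ = restrict-inj {l} {m} τ q
    injσ = restrict-inj {m} {n} σ p
    agree : ∀ i → f π (toℕ i) ≡ toℕ (ρσ (ρτ i))
    agree i = begin
      f π (toℕ i)         ≡⟨ sym (στ≗π (toℕ i)) ⟩
      f σ (f τ (toℕ i))   ≡⟨ cong (f σ) (sym (toℕ-fromℕ< _)) ⟩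
      f σ (toℕ (ρτ i))    ≡⟨ sym (toℕ-fromℕ< _) ⟩
      toℕ (ρσ (ρτ i))     ∎
      where open ≡-Reasoning

  IncImg-mono : ∀ m n {B D : Pred (R m) 0ℓ} → B ⊆ D → IncImg C m n B ⊆ IncImg C m n D
  IncImg-mono m n B⊆D (π , p , x , x∈B , refl) = π , p , x , B⊆D x∈B , refl

  IncImg-id : ∀ {m} {B : Pred (R m) 0ℓ} → 1 ≤ m → B ⊆ IncImg C m m B
  IncImg-id {m} 1≤m {x} x∈B = idᴵ , IncMN-id 1≤m , x , x∈B , sym (actInc-id {m} (IncMN-id 1≤m) x)

  IncImg-∘ : ∀ {m n o} {B : Pred (R m) 0ℓ} → IncImg C n o (IncImg C m n B) ⊆ IncImg C m o B
  IncImg-∘ {m} {n} {o} (σ , p , _ , (τ , q , x , x∈B , refl) , refl) =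
    σ ∘ᴵ τ , s , x , x∈B , sym (actInc-∘ {m} {n} {o} τ σ (σ ∘ᴵ τ) q p s (λ _ → refl) x)
    where
    s = IncMN-∘ {m} {n} {o} {σ} {τ} p q

  IncImg-factor : ∀ {r m n} {B : Pred (R r) 0ℓ} → 1 ≤ r → r ≤ m → m ≤ n →
                  IncImg C r n B ⊆ IncImg C m n (IncImg C r m B)
  IncImg-factor {r} {m} {n} 1≤r r≤m m≤n (π , p , x , x∈B , refl)
    with Inc-factor {r} {m} {n} π 1≤r r≤m m≤n p
  ... | τ , σ , q , p′ , στ≗π =
    σ , p′ , actInc C {r} {m} τ q x , (τ , q , x , x∈B , refl) ,
    actInc-∘ {r} {m} {n} τ σ π q p′ p στ≗π x

  module _ (CL : ClosureFamily C) where

    IncSpan : ∀ m n → Pred (R m) 0ℓ → Pred (R n) 0ℓ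
    IncSpan m n B = cl C CL n (IncImg C m n B)

    private
      cl-mono : ∀ n {B D : Pred (R n) 0ℓ} → B ⊆ D → cl C CL n B ⊆ cl C CL n D
      cl-mono n = ClosureOp.monotone (CL n)

      cl-ext : ∀ n {B : Pred (R n) 0ℓ} → B ⊆ cl C CL n B
      cl-ext n = ClosureOp.extensive (CL n) _

    IncSpan-mono : ∀ m n {B D : Pred (R m) 0ℓ} → B ⊆ D → IncSpan m n B ⊆ IncSpan m n D
    IncSpan-mono m n = cl-mono n ∘ IncImg-mono m n

    IncSpan-refl : ∀ {m} {B : Pred (R m) 0ℓ} → 1 ≤ m → B ⊆ IncSpan m m B
    IncSpan-refl {m} 1≤m = cl-ext m ∘ IncImg-id 1≤m

    IncSpan-factor : ∀ {r m n} {B : Pred (R r) 0ℓ} → 1 ≤ r → r ≤ m → m ≤ n →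
                     IncSpan r n B ⊆ IncSpan m n (IncSpan r m B)
    IncSpan-factor {r} {m} {n} 1≤r r≤m m≤n =
      cl-mono n (IncImg-mono m n (cl-ext m) ∘ IncImg-factor 1≤r r≤m m≤n)

    IncSpan-trans : CompatibleWithInc C CL →
                    ∀ {m n o} {B : Pred (R m) 0ℓ} {D : Pred (R n) 0ℓ} → 1 ≤ n → n ≤ o →
                    D ⊆ IncSpan m n B → IncSpan n o D ⊆ IncSpan m o B
    IncSpan-trans comp {m} {n} {o} {B} 1≤n n≤o D⊆ =
      cl-mono o IncImg-∘
      ∘ proj₁ (ClosureOp.idempotent (CL o) _)
      ∘ cl-mono o (comp n o 1≤n n≤o _)
      ∘ IncSpan-mono n o D⊆

    module _ (A : (n : ℕ) → Pred (R n) 0ℓ) (inv : IsIncInvariant C CL A) where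

      StableFrom StableStepsFrom GeneratedFrom : ℕ → Set
      StableFrom r = ∀ m n → r ≤ m → m ≤ n → IncSpan m n (A m) ≐ A n
      StableStepsFrom r = ∀ n → r ≤ n → IncSpan n (suc n) (A n) ≐ A (suc n)
      GeneratedFrom r = ∀ n → r ≤ n → IncSpan r n (A r) ≐ A n

      IncSpan≐ : ∀ {m n} → 1 ≤ m → m ≤ n → A n ⊆ IncSpan m n (A m) → IncSpan m n (A m) ≐ A n
      IncSpan≐ {m} {n} 1≤m m≤n A⊆ = inv m n 1≤m m≤n , A⊆

      stableFrom⇒stableStepsFrom : ∀ {r} → StableFrom r → StableStepsFrom r
      stableFrom⇒stableStepsFrom h n r≤n = h n (suc n) r≤n (n≤1+n n)

      stableFrom⇒generatedFrom : ∀ {r} → StableFrom r → GeneratedFrom r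
      stableFrom⇒generatedFrom h n r≤n = h _ n ≤-refl r≤n

      stableStepsFrom⇒stableFrom : CompatibleWithInc C CL → ∀ {r} → 1 ≤ r →
                                   StableStepsFrom r → StableFrom r
      stableStepsFrom⇒stableFrom comp {r} 1≤r h m n r≤m m≤n =
        IncSpan≐ 1≤m m≤n (spans (≤⇒≤′ m≤n))
        where
        1≤m = ≤-trans 1≤r r≤m
        spans : ∀ {k} → m ≤′ k → A k ⊆ IncSpan m k (A m)
        spans ≤′-refl = IncSpan-refl 1≤m
        spans (≤′-step {k} m≤′k) =
          IncSpan-trans comp (≤-trans 1≤m m≤k) (n≤1+n k) (spans m≤′k)
          ∘ proj₂ (h k (≤-trans r≤m m≤k))
          where m≤k = ≤′⇒≤ m≤′k

      generatedFrom⇒stableFrom : ∀ {r} → 1 ≤ r → GeneratedFrom r → StableFrom r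
      generatedFrom⇒stableFrom {r} 1≤r h m n r≤m m≤n =
        IncSpan≐ (≤-trans 1≤r r≤m) m≤n
          ( IncSpan-mono m n (inv r m 1≤r r≤m)
          ∘ IncSpan-factor 1≤r r≤m m≤n
          ∘ proj₂ (h n (≤-trans r≤m m≤n)))

proposition4p9 : (C : AmbientChain) (CL : ClosureFamily C) →
    CompatibleWithInc C CL →
    (A : (n : ℕ) → Pred (AmbientChain.R C n) 0ℓ) →
    IsChain C CL A → IsClosedChain C CL A → IsIncInvariant C CL A →
    (r : ℕ) → 1 ≤ r →
    ((∀ m n → r ≤ m → m ≤ n → cl C CL n (IncImg C m n (A m)) ≐ A n)
      ⇔ (∀ n → r ≤ n → cl C CL (suc n) (IncImg C n (suc n) (A n)) ≐ A (suc n)))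
    × ((∀ m n → r ≤ m → m ≤ n → cl C CL n (IncImg C m n (A m)) ≐ A n)
      ⇔ (∀ n → r ≤ n → cl C CL n (IncImg C r n (A r)) ≐ A n))
proposition4p9 C CL comp A _ _ inv r 1≤r =
  mk⇔ (stableFrom⇒stableStepsFrom C CL A inv) (stableStepsFrom⇒stableFrom C CL A inv comp 1≤r) ,
  mk⇔ (stableFrom⇒generatedFrom C CL A inv) (generatedFrom⇒stableFrom C CL A inv 1≤r)
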